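{- Let $\ell,k\ge 0$ be integers and let $\mathcal Q$ be an $\ell$-ary query over a relational input schema $\tau_{\mathrm{in}}$ that is expressible by a semi-positive existential first-order formula with $k$ (existential) quantifiers. Then $\mathcal Q$ can be maintained under insertions in $(\ell+k-1)$-ary $\mathrm{DynProp}$, i.e. by a dynamic program with quantifier-free update formulas all of whose auxiliary relations have arity at most $\ell+k-1$.
   Context: A semi-positive existential first-order formula over a relational schema is a formula of the form $\varphi(\vec y)=\exists \vec x\,\psi(\vec x,\vec y)$, where $\psi$ is quantifier-free and contains no negations except possibly literals of the form $z_i\neq z_j$ between variables; $k=|\vec x|$ is the number of quantifiers. Dynamic complexity framework. A dynamic schema is a pair $(\tau_{\mathrm{in}},\tau_{\mathrm{aux}})$ of an input schema and an auxiliary schema ($\tau_{\mathrm{aux}}$ consists of relation symbols only); put $\tau=\tau_{\mathrm{in}}\cup\tau_{\mathrm{aux}}$. A modification of a database over a finite domain $D$ is an insertion $\mathrm{ins}_S(\vec a)$ or a deletion $\mathrm{del}_S(\vec a)$ of a tuple $\vec a$ over $D$ into/from a relation $S\in\tau_{\mathrm{in}}$. An update program $P$ contains, for each $R\in\tau_{\mathrm{aux}}$ and each $\delta\in\{\mathrm{ins}_S,\mathrm{del}_S\}$ with $S\in\tau_{\mathrm{in}}$, a first-order formula $\varphi^R_\delta(\vec x;\vec y)$ over $\tau$ with $|\vec x|$ the arity of $S$ and $|\vec y|$ the arity of $R$. A program state is a structure $(D,\mathcal I,\mathcal A)$ with $\mathcal I$ an input database and $\mathcal A$ an auxiliary database over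 domain $D$. Applying $\delta(\vec a)$ to a state $\mathcal S$ yields the state in which the input database is modified by $\delta(\vec a)$ and each $R\in\tau_{\mathrm{aux}}$ is reinterpreted as $\{\vec b:\mathcal S\models\varphi^R_\delta(\vec a;\vec b)\}$ (evaluated in the old state $\mathcal S$); sequences of modifications are applied one after another. A dynamic program is a triple $(P,\mathrm{Init},Q)$ with $P$ an update program, $\mathrm{Init}$ an arbitrary mapping from input databases to auxiliary databases over the same domain, and $Q\in\tau_{\mathrm{aux}}$ a designated query symbol. It maintains a query $\mathcal Q$ if for every input database $\mathcal D$ over any finite domain $D$ and every sequence $\alpha$ of modifications, the interpretation of $Q$ in the state obtained from $(D,\mathcal D,\mathrm{Init}(\mathcal D))$ by applying $\alpha$ equals $\mathcal Q(\alpha(\mathcal D))$, where $\alpha(\mathcal D)$ is the database after applying $\alpha$. "Maintained under insertions" means this is required only for sequences $\alpha$ consisting solely of insertions. $\mathrm{DynProp}$ is the class of queries maintainable by dynamic programs whose update formulas are quantifier-free; the program is $m$-ary if all auxiliary relation symbols have arity at most $m$. -}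

module Defs where

open import Data.Nat using (ℕ; zero; suc; _+_; _≤_)
open import Data.Fin using (Fin)
open import Data.Fin.Properties using (_≟_)
open import Data.Vec using (Vec; []; _∷_; lookup; _++_)
import Data.Vec as Vec
open import Data.Vec.Properties using (≡-dec)
open import Data.Bool using (Bool; true; false; _∧_; _∨_; not; if_then_else_)
open import Data.List using (List; []; _∷_; allFin; foldl)
open import Data.Bool.ListAction using (any; all)
open import Data.List.Relation.Unary.All using (All)
open import Data.Sum using (_⊎_; inj₁; inj₂; [_,_])
open import Relation.Nullary using (yes; no)
open import Relation.Nullary.Decidable using (⌊_⌋)
open import Relation.Binary.PropositionalEquality using (_≡_; refl; sym; subst)

record Sig : Set₁ where
  field
    Sym : Set
    ar  : Sym → ℕ

record Schema : Set where
  field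
    size : ℕ
    ar   : Fin size → ℕ

  Sym : Set
  Sym = Fin size

sig : Schema → Sig
sig σ = record { Sym = Schema.Sym σ ; ar = Schema.ar σ }

_⊕_ : Schema → Schema → Sig
τin ⊕ τaux = record
  { Sym = Schema.Sym τin ⊎ Schema.Sym τaux
  ; ar  = [ Schema.ar τin , Schema.ar τaux ] }

-- Structures over the finite domain Fin n (every finite domain is
-- isomorphic to some Fin n).  Relations are decidable (Bool-valued).

Structure : Sig → ℕ → Set
Structure σ n = (R : Sig.Sym σ) → Vec (Fin n) (Sig.ar σ R) → Bool

DB : Schema → ℕ → Set
DB σ n = Structure (sig σ) n

-- First-order formulas with v variables in scope (de Bruijn style:
-- a quantifier binds the new variable 'zero').  Relational schemas:
-- atoms take variables as arguments.

data Formula (σ : Sig) (v : ℕ) : Set where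
  atom : (R : Sig.Sym σ) → Vec (Fin v) (Sig.ar σ R) → Formula σ v
  eq   : Fin v → Fin v → Formula σ v
  neg  : Formula σ v → Formula σ v
  and  : Formula σ v → Formula σ v → Formula σ v
  or   : Formula σ v → Formula σ v → Formula σ v
  ex   : Formula σ (suc v) → Formula σ v
  fa   : Formula σ (suc v) → Formula σ v

eval : ∀ {σ n v} → Structure σ n → Formula σ v → Vec (Fin n) v → Bool
eval 𝒜 (atom R xs) ρ = 𝒜 R (Vec.map (lookup ρ) xs)
eval 𝒜 (eq x y)    ρ = ⌊ lookup ρ x ≟ lookup ρ y ⌋
eval 𝒜 (neg φ)     ρ = not (eval 𝒜 φ ρ)
eval 𝒜 (and φ ψ)   ρ = eval 𝒜 φ ρ ∧ eval 𝒜 ψ ρ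
eval 𝒜 (or φ ψ)    ρ = eval 𝒜 φ ρ ∨ eval 𝒜 ψ ρ
eval {n = n} 𝒜 (ex φ) ρ = any (λ d → eval 𝒜 φ (d ∷ ρ)) (allFin n)
eval {n = n} 𝒜 (fa φ) ρ = all (λ d → eval 𝒜 φ (d ∷ ρ)) (allFin n)

data QF {σ : Sig} {v : ℕ} : Formula σ v → Set where
  atom : ∀ R xs → QF (atom R xs)
  eq   : ∀ x y → QF (eq x y)
  neg  : ∀ {φ} → QF φ → QF (neg φ)
  and  : ∀ {φ ψ} → QF φ → QF ψ → QF (and φ ψ)
  or   : ∀ {φ ψ} → QF φ → QF ψ → QF (or φ ψ)

data SemiPosQF {σ : Sig} {v : ℕ} : Formula σ v → Set where
  atom : ∀ R xs → SemiPosQF (atom R xs)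
  eq   : ∀ x y → SemiPosQF (eq x y)
  neq  : ∀ x y → SemiPosQF (neg (eq x y))
  and  : ∀ {φ ψ} → SemiPosQF φ → SemiPosQF ψ → SemiPosQF (and φ ψ)
  or   : ∀ {φ ψ} → SemiPosQF φ → SemiPosQF ψ → SemiPosQF (or φ ψ)

-- ∃x₁…∃x_k ψ : the k existentially quantified variables are the first k
-- variables of ψ, the remaining v are the free variables.
exists^ : ∀ {σ v} (k : ℕ) → Formula σ (k + v) → Formula σ v
exists^ zero    ψ = ψ
exists^ (suc k) ψ = exists^ k (ex ψ)

Query : Schema → ℕ → Set
Query τin ℓ = ∀ {n} → DB τin n → Vec (Fin n) ℓ → Bool

queryOf : ∀ {τin ℓ} → Formula (sig τin) ℓ → Query τin ℓ
queryOf φ 𝒟 b = eval 𝒟 φ b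

data Mod (τin : Schema) (n : ℕ) : Set where
  ins : (S : Schema.Sym τin) → Vec (Fin n) (Schema.ar τin S) → Mod τin n
  del : (S : Schema.Sym τin) → Vec (Fin n) (Schema.ar τin S) → Mod τin n

data IsInsertion {τin : Schema} {n : ℕ} : Mod τin n → Set where
  ins : ∀ S a → IsInsertion (ins S a)

insertTuple : ∀ {τin n} → DB τin n → (S : Schema.Sym τin) →
              Vec (Fin n) (Schema.ar τin S) → DB τin n
insertTuple 𝒟 S a S' t with S' ≟ S
... | yes refl = 𝒟 S t ∨ ⌊ ≡-dec _≟_ t a ⌋
... | no _     = 𝒟 S' t

deleteTuple : ∀ {τin n} → DB τin n → (S : Schema.Sym τin) →
              Vec (Fin n) (Schema.ar τin S) → DB τin n
deleteTuple 𝒟 S a S' t with S' ≟ S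
... | yes refl = 𝒟 S t ∧ not ⌊ ≡-dec _≟_ t a ⌋
... | no _     = 𝒟 S' t

applyMod : ∀ {τin n} → DB τin n → Mod τin n → DB τin n
applyMod 𝒟 (ins S a) = insertTuple 𝒟 S a
applyMod 𝒟 (del S a) = deleteTuple 𝒟 S a

applyMods : ∀ {τin n} → DB τin n → List (Mod τin n) → DB τin n
applyMods = foldl applyMod

-- Update formula φ^R_δ(x⃗; y⃗) for δ ∈ {ins_S, del_S}: a formula over
-- τ = τ_in ∪ τ_aux whose first |x⃗| = ar S variables are x⃗ and whose
-- last |y⃗| = ar R variables are y⃗.
UpdFormula : (τin τaux : Schema) → Schema.Sym τin → Schema.Sym τaux → Set
UpdFormula τin τaux S R =
  Formula (τin ⊕ τaux) (Schema.ar τin S + Schema.ar τaux R)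

record DynProgram (τin τaux : Schema) (ℓ : ℕ) : Set where
  field
    updIns : (S : Schema.Sym τin) (R : Schema.Sym τaux) → UpdFormula τin τaux S R
    updDel : (S : Schema.Sym τin) (R : Schema.Sym τaux) → UpdFormula τin τaux S R
    Init   : ∀ {n} → DB τin n → DB τaux n
    Q      : Schema.Sym τaux
    Q-ar   : Schema.ar τaux Q ≡ ℓ

record State (τin τaux : Schema) (n : ℕ) : Set where
  constructor state
  field
    inp : DB τin n
    aux : DB τaux n

combine : ∀ {τin τaux n} → State τin τaux n → Structure (τin ⊕ τaux) n
combine (state I A) (inj₁ S) = I S
combine (state I A) (inj₂ R) = A R

module _ {τin τaux : Schema} {ℓ : ℕ} (P : DynProgram τin τaux ℓ) where
  open DynProgram P

  step : ∀ {n} → State τin τaux n → Mod τin n → State τin τaux n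
  step 𝒮 (ins S a) = state (applyMod (State.inp 𝒮) (ins S a))
                           (λ R b → eval (combine 𝒮) (updIns S R) (a ++ b))
  step 𝒮 (del S a) = state (applyMod (State.inp 𝒮) (del S a))
                           (λ R b → eval (combine 𝒮) (updDel S R) (a ++ b))

  run : ∀ {n} → State τin τaux n → List (Mod τin n) → State τin τaux n
  run = foldl step

  initState : ∀ {n} → DB τin n → State τin τaux n
  initState 𝒟 = state 𝒟 (Init 𝒟)

  IsDynProp : Set
  IsDynProp = (∀ S R → QF (updIns S R)) × (∀ S R → QF (updDel S R))
    where open import Data.Product using (_×_)

  IsAry : ℕ → Set
  IsAry m = ∀ (R : Schema.Sym τaux) → Schema.ar τaux R ≤ m

  MaintainsUnderInsertions : Query τin ℓ → Set
  MaintainsUnderInsertions 𝒬 =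
    ∀ (n : ℕ) (𝒟 : DB τin n) (α : List (Mod τin n)) → All IsInsertion α →
    ∀ (b : Vec (Fin n) ℓ) →
      State.aux (run (initState 𝒟) α) Q (subst (Vec (Fin n)) (sym Q-ar) b)
        ≡ 𝒬 (applyMods 𝒟 α) b

module Submission where

-- A forcing F declares some atom occurrences of ψ true; write ψ_F for the result. For
-- every partial assignment s of the k + ℓ variables of ψ with at least one free variable, an
-- auxiliary relation records whether s extends to a satisfying assignment of ψ_F. Its arity, the
-- number of bound variables, is at most ℓ + k − 1, and the query is the case where exactly the k
-- quantified variables are free. As ψ is semi-positive, inserting S(a) only makes atoms true: s
-- extends afterwards iff it extended before, or it extends to an assignment sending some unforced
-- S-atom of ψ_F to a; binding that atom's variables to a and forcing it reduces the question to a
-- larger forcing. Unfolding this at most once per atom of ψ, and evaluating ψ_F directly once s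
-- is total, gives quantifier-free update formulas.

open import Defs
open import Data.Bool using (Bool; true; false; T; _∧_; _∨_; not)
open import Data.Bool.Properties using (T-∧; T-∨; ∨-inverseʳ; ∧-inverseʳ)
open import Data.Bool.ListAction using (any) renaming (or to disjunction)
open import Data.Empty using (⊥; ⊥-elim)
open import Data.Fin using (Fin; zero; suc; _↑ˡ_; _↑ʳ_)
open import Data.Fin.Properties using (_≟_; 0↔⊥; 1↔⊤; 2↔Bool; +↔⊎; *↔×)
open import Data.List using (List; []; _∷_; allFin)
import Data.List.Properties as List
open import Data.List.Membership.Propositional using (lose)
open import Data.List.Membership.Propositional.Properties using (∈-allFin)
open import Data.List.Relation.Unary.All using (All; []; _∷_)
open import Data.List.Relation.Unary.Any using (satisfied)
open import Data.List.Relation.Unary.Any.Properties using (any⁺; any⁻)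
open import Data.Maybe using (Maybe; just; nothing; _<∣>_; Is-just; is-nothing)
import Data.Maybe as Maybe
open import Data.Maybe.Properties using (map-<∣>)
open import Data.Maybe.Relation.Unary.All using (just; nothing) renaming (All to MaybeAll)
open import Data.Maybe.Relation.Unary.Any using (just)
open import Data.Nat using (ℕ; zero; suc; pred; _+_; _*_; _∸_; _⊔_; _≤_; _<_; z≤n; s≤s)
open import Data.Nat.Properties
  using (≤-refl; ≤-trans; ≤-pred; n≤1+n; +-comm; +-mono-≤; +-monoˡ-<; +-monoʳ-<; m≤m⊔n; m≤n⊔m;
         pred[m∸n]≡m∸[1+n]; suc[m]≤n⇒m≤pred[n])
open import Data.Product using (Σ; ∃-syntax; _×_; _,_; proj₁; proj₂; uncurry)
import Data.Product as Product
open import Data.Product.Function.NonDependent.Propositional using (_×-↔_)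
open import Data.Sum using (_⊎_; inj₁; inj₂)
import Data.Sum as Sum
open import Data.Sum.Function.Propositional using (_⊎-↔_)
open import Data.Unit using (⊤; tt)
open import Data.Vec using (Vec; []; _∷_; _++_; lookup; map; replicate; tabulate; updateAt; uncons)
open import Data.Vec.Properties
  using (≡-dec; map-updateAt; map-∘; map-cong; map-++; map-replicate; lookup-map; lookup-++ˡ; lookup-++ʳ;
         ∷-injective; tabulate-∘; tabulate-cong; tabulate∘lookup)
open import Data.Vec.Relation.Binary.Pointwise.Inductive using (Pointwise; []; _∷_)
import Data.Vec.Relation.Binary.Pointwise.Inductive as Pointwise
import Data.Vec.Relation.Unary.All as VecAll
open import Function using (_∘_; id)
open import Function.Bundles using (_↔_; _⇔_; mk↔ₛ′; mk⇔; Equivalence; Inverse)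
open import Function.Properties.Inverse using (↔-trans; ↔-sym)
open import Relation.Nullary using (yes; no; ¬_; contradiction)
open import Relation.Nullary.Decidable using (⌊_⌋; toWitness; fromWitness)
open import Relation.Binary.PropositionalEquality using (_≡_; _≗_; refl; sym; trans; cong; cong₂; subst)
open Relation.Binary.PropositionalEquality.≡-Reasoning

open Equivalence using (to; from)

private variable
  V m n w : ℕ

T-injective : ∀ {a b} → T a ⇔ T b → a ≡ b
T-injective {false} {false} _ = refl
T-injective {false} {true}  e = ⊥-elim (from e tt)
T-injective {true}  {false} e = ⊥-elim (to e tt)
T-injective {true}  {true}  _ = refl

∧-map : ∀ {a b c d} → (T a → T c) → (T b → T d) → T (a ∧ b) → T (c ∧ d)
∧-map {a} {c = c} f g p = from (T-∧ {c}) (Product.map f g (to (T-∧ {a}) p))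

∨-map : ∀ {a b c d} → (T a → T c) → (T b → T d) → T (a ∨ b) → T (c ∨ d)
∨-map {a} {c = c} f g p = from (T-∨ {c}) (Sum.map f g (to (T-∨ {a}) p))

record Finite (A : Set) : Set where
  field
    size : ℕ
    enum : Fin size ↔ A

open Finite

finite-⊥ : Finite ⊥
finite-⊥ = record { size = 0 ; enum = 0↔⊥ }

finite-⊤ : Finite ⊤
finite-⊤ = record { size = 1 ; enum = 1↔⊤ }

finite-Bool : Finite Bool
finite-Bool = record { size = 2 ; enum = 2↔Bool }

finite-× : ∀ {A B} → Finite A → Finite B → Finite (A × B)
finite-× FA FB = record { size = size FA * size FB ; enum = ↔-trans *↔× (enum FA ×-↔ enum FB) }

finite-⊎ : ∀ {A B} → Finite A → Finite B → Finite (A ⊎ B)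
finite-⊎ FA FB = record { size = size FA + size FB ; enum = ↔-trans +↔⊎ (enum FA ⊎-↔ enum FB) }

Vec0↔⊤ : ∀ {A : Set} → Vec A 0 ↔ ⊤
Vec0↔⊤ = mk↔ₛ′ _ (λ _ → []) (λ _ → refl) (λ { [] → refl })

Vec-suc↔× : ∀ {A : Set} {m} → Vec A (suc m) ↔ (A × Vec A m)
Vec-suc↔× = mk↔ₛ′ uncons (uncurry _∷_) (λ _ → refl) (λ { (_ ∷ _) → refl })

finite-Vec : ∀ {A} → Finite A → ∀ m → Finite (Vec A m)
finite-Vec FA zero    = record { size = 1 ; enum = ↔-trans 1↔⊤ (↔-sym Vec0↔⊤) }
finite-Vec FA (suc m) = record
  { size = size FA×Vec ; enum = ↔-trans (enum FA×Vec) (↔-sym Vec-suc↔×) }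
  where FA×Vec = finite-× FA (finite-Vec FA m)

-- Partial assignments

module _ {A : Set} where

  Extends : Vec A V → Vec (Maybe A) V → Set
  Extends = Pointwise (λ d m → MaybeAll (d ≡_) m)

  bindAt : Fin V → A → Vec (Maybe A) V → Vec (Maybe A) V
  bindAt z c σ = updateAt σ z (_<∣> just c)

  bind : Vec (Fin V) m → Vec A m → Vec (Maybe A) V → Vec (Maybe A) V
  bind []       []       σ = σ
  bind (z ∷ zs) (c ∷ cs) σ = bind zs cs (bindAt z c σ)

  bindAt-binds : ∀ (z : Fin V) c σ → Is-just (lookup (bindAt z c σ) z)
  bindAt-binds zero    c (just _ ∷ σ)  = just tt
  bindAt-binds zero    c (nothing ∷ σ) = just tt
  bindAt-binds (suc z) c (_ ∷ σ)       = bindAt-binds z c σ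

  bindAt-keeps : ∀ (z : Fin V) c σ i → Is-just (lookup σ i) → Is-just (lookup (bindAt z c σ) i)
  bindAt-keeps zero    c (just _ ∷ σ) zero    p = p
  bindAt-keeps zero    c (_ ∷ σ)      (suc i) p = p
  bindAt-keeps (suc z) c (_ ∷ σ)      zero    p = p
  bindAt-keeps (suc z) c (_ ∷ σ)      (suc i) p = bindAt-keeps z c σ i p

  bind-keeps : ∀ (zs : Vec (Fin V) m) cs σ i → Is-just (lookup σ i) → Is-just (lookup (bind zs cs σ) i)
  bind-keeps []       []       σ i p = p
  bind-keeps (z ∷ zs) (c ∷ cs) σ i p = bind-keeps zs cs _ i (bindAt-keeps z c σ i p)

  bind-binds : ∀ (zs : Vec (Fin V) m) cs σ → VecAll.All (λ z → Is-just (lookup (bind zs cs σ) z)) zs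
  bind-binds []       []       σ = VecAll.[]
  bind-binds (z ∷ zs) (c ∷ cs) σ = bind-keeps zs cs _ z (bindAt-binds z c σ) VecAll.∷ bind-binds zs cs _

  extends-bindAt : ∀ {ρ : Vec A V} {σ} z → Extends ρ σ → Extends ρ (bindAt z (lookup ρ z) σ)
  extends-bindAt zero    (just p ∷ ext)  = just p ∷ ext
  extends-bindAt zero    (nothing ∷ ext) = just refl ∷ ext
  extends-bindAt (suc z) (p ∷ ext)       = p ∷ extends-bindAt z ext

  extends-unbindAt : ∀ {ρ : Vec A V} z c σ → Extends ρ (bindAt z c σ) → Extends ρ σ
  extends-unbindAt zero    c (just _ ∷ σ)  (p ∷ ext) = p ∷ ext
  extends-unbindAt zero    c (nothing ∷ σ) (_ ∷ ext) = nothing ∷ ext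
  extends-unbindAt (suc z) c (_ ∷ σ)       (p ∷ ext) = p ∷ extends-unbindAt z c σ ext

  extends-bind : ∀ {ρ σ} (zs : Vec (Fin V) m) {cs} → Extends ρ σ → map (lookup ρ) zs ≡ cs →
                 Extends ρ (bind zs cs σ)
  extends-bind []       ext refl = ext
  extends-bind (z ∷ zs) ext refl = extends-bind zs (extends-bindAt z ext) refl

  extends-unbind : ∀ {ρ} (zs : Vec (Fin V) m) cs σ → Extends ρ (bind zs cs σ) → Extends ρ σ
  extends-unbind []       []       σ ext = ext
  extends-unbind (z ∷ zs) (c ∷ cs) σ ext = extends-unbindAt z c σ (extends-unbind zs cs _ ext)

map-bind : ∀ {A B : Set} (f : A → B) (zs : Vec (Fin V) m) cs σ →
           map (Maybe.map f) (bind zs cs σ) ≡ bind zs (map f cs) (map (Maybe.map f) σ)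
map-bind f []       []       σ = refl
map-bind f (z ∷ zs) (c ∷ cs) σ =
  trans (map-bind f zs cs _) (cong (bind zs (map f cs)) (map-updateAt σ z (map-<∣> f (lookup σ z) _)))

anyValue : Maybe (Fin n) → (Fin n → Bool) → Bool
anyValue         (just d) f = f d
anyValue {n = n} nothing  f = any f (allFin n)

anyExtension : Vec (Maybe (Fin n)) V → (Vec (Fin n) V → Bool) → Bool
anyExtension []      f = f []
anyExtension (d? ∷ σ) f = anyExtension σ (λ ρ → anyValue d? (λ d → f (d ∷ ρ)))

anyValue-sound : ∀ (d? : Maybe (Fin n)) f → T (anyValue d? f) → ∃[ d ] MaybeAll (d ≡_) d? × T (f d)
anyValue-sound (just d) f p = d , just refl , p
anyValue-sound {n = n} nothing f p = let d , q = satisfied (any⁻ f (allFin n) p) in d , nothing , q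

anyValue-complete : ∀ {d : Fin n} d? f → MaybeAll (d ≡_) d? → T (f d) → T (anyValue d? f)
anyValue-complete (just _) f (just refl) p = p
anyValue-complete nothing  f nothing     p = any⁺ f (lose (∈-allFin _) p)

anyValue-cong : ∀ (d? : Maybe (Fin n)) {f g} → f ≗ g → anyValue d? f ≡ anyValue d? g
anyValue-cong (just d) f≗g = f≗g d
anyValue-cong {n = n} nothing f≗g = cong disjunction (List.map-cong f≗g (allFin n))

anyExtension-sound : ∀ (σ : Vec (Maybe (Fin n)) V) f → T (anyExtension σ f) →
                     ∃[ ρ ] Extends ρ σ × T (f ρ)
anyExtension-sound []      f p = [] , [] , p
anyExtension-sound (d? ∷ σ) f p =
  let ρ , ρ⊒σ , q = anyExtension-sound σ _ p
      d , d⊒d? , r = anyValue-sound d? _ q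
  in  d ∷ ρ , d⊒d? ∷ ρ⊒σ , r

anyExtension-complete : ∀ (σ : Vec (Maybe (Fin n)) V) f {ρ} → Extends ρ σ → T (f ρ) →
                        T (anyExtension σ f)
anyExtension-complete []      f []          p = p
anyExtension-complete (d? ∷ σ) f (d⊒d? ∷ ρ⊒σ) p =
  anyExtension-complete σ _ ρ⊒σ (anyValue-complete d? _ d⊒d? p)

anyExtension-total : ∀ (ρ : Vec (Fin n) V) f → anyExtension (map just ρ) f ≡ f ρ
anyExtension-total []      f = refl
anyExtension-total (d ∷ ρ) f = anyExtension-total ρ _

anyExtension-cong : ∀ (σ : Vec (Maybe (Fin n)) V) {f g} → f ≗ g → anyExtension σ f ≡ anyExtension σ g
anyExtension-cong []      f≗g = f≗g []
anyExtension-cong (d? ∷ σ) f≗g = anyExtension-cong σ (λ ρ → anyValue-cong d? (λ d → f≗g (d ∷ ρ)))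

eval-exists^ : ∀ {𝕊 : Sig} (𝒜 : Structure 𝕊 n) k (φ : Formula 𝕊 (k + V)) ρ →
               eval 𝒜 (exists^ k φ) ρ ≡ anyExtension (replicate k nothing ++ map just ρ) (eval 𝒜 φ)
eval-exists^ 𝒜 zero    φ ρ = sym (anyExtension-total ρ (eval 𝒜 φ))
eval-exists^ 𝒜 (suc k) φ ρ = eval-exists^ 𝒜 k (ex φ) ρ

-- Patterns: true marks a free position.

#bound : Vec Bool V → ℕ
#bound []          = 0
#bound (true ∷ r)  = #bound r
#bound (false ∷ r) = suc (#bound r)

#bound≤ : (r : Vec Bool V) → #bound r ≤ V
#bound≤ []          = z≤n
#bound≤ (true ∷ r)  = ≤-trans (#bound≤ r) (n≤1+n _)
#bound≤ (false ∷ r) = s≤s (#bound≤ r)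

instantiate : ∀ {A : Set} (r : Vec Bool V) → Vec A (#bound r) → Vec (Maybe A) V
instantiate []          []         = []
instantiate (true ∷ r)  args       = nothing ∷ instantiate r args
instantiate (false ∷ r) (a ∷ args) = just a ∷ instantiate r args

map-instantiate : ∀ {A B : Set} (f : A → B) (r : Vec Bool V) args →
                  instantiate r (map f args) ≡ map (Maybe.map f) (instantiate r args)
map-instantiate f []          []         = refl
map-instantiate f (true ∷ r)  args       = cong (nothing ∷_) (map-instantiate f r args)
map-instantiate f (false ∷ r) (a ∷ args) = cong (just (f a) ∷_) (map-instantiate f r args)

PartialPattern : ℕ → Set
PartialPattern zero    = ⊥
PartialPattern (suc V) = Vec Bool V ⊎ PartialPattern V

toPattern : PartialPattern V → Vec Bool V
toPattern {suc V} (inj₁ r) = true ∷ r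
toPattern {suc V} (inj₂ x) = false ∷ toPattern x

#bound-toPattern< : (x : PartialPattern V) → #bound (toPattern x) < V
#bound-toPattern< {suc V} (inj₁ r) = s≤s (#bound≤ r)
#bound-toPattern< {suc V} (inj₂ x) = s≤s (#bound-toPattern< x)

finite-PartialPattern : ∀ V → Finite (PartialPattern V)
finite-PartialPattern zero    = finite-⊥
finite-PartialPattern (suc V) = finite-⊎ (finite-Vec finite-Bool V) (finite-PartialPattern V)

module _ {A : Set} where

  boundValues : (σ : Vec (Maybe A) V) → Vec A (#bound (map is-nothing σ))
  boundValues []           = []
  boundValues (just a ∷ σ) = a ∷ boundValues σ
  boundValues (nothing ∷ σ) = boundValues σ

  instantiate-boundValues : (σ : Vec (Maybe A) V) → instantiate (map is-nothing σ) (boundValues σ) ≡ σ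
  instantiate-boundValues []            = refl
  instantiate-boundValues (just a ∷ σ)  = cong (just a ∷_) (instantiate-boundValues σ)
  instantiate-boundValues (nothing ∷ σ) = cong (nothing ∷_) (instantiate-boundValues σ)

  data Totality (σ : Vec (Maybe A) V) : Set where
    total   : (ρ : Vec A V) → σ ≡ map just ρ → Totality σ
    partial : (x : PartialPattern V) (args : Vec A (#bound (toPattern x))) →
              instantiate (toPattern x) args ≡ σ → Totality σ

  totality : (σ : Vec (Maybe A) V) → Totality σ
  totality []            = total [] refl
  totality (nothing ∷ σ) =
    partial (inj₁ (map is-nothing σ)) (boundValues σ) (cong (nothing ∷_) (instantiate-boundValues σ))
  totality (just a ∷ σ) with totality σ
  ... | total ρ σ≡ρ          = total (a ∷ ρ) (cong (just a ∷_) σ≡ρ)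
  ... | partial x args σ≡x   = partial (inj₂ x) (a ∷ args) (cong (just a ∷_) σ≡x)

-- Insertions and forced atoms

module _ {τin : Schema} where
  private
    Sym = Schema.Sym τin
    ar  = Schema.ar τin
    variable φ : Formula (sig τin) V

  insertTuple-⊇ : ∀ (D : DB τin n) S a R t → T (D R t) → T (insertTuple D S a R t)
  insertTuple-⊇ D S a R t p with R ≟ S
  ... | yes refl = from (T-∨ {D R t}) (inj₁ p)
  ... | no  _    = p

  insertTuple-new : ∀ (D : DB τin n) S a → T (insertTuple D S a S a)
  insertTuple-new D S a with S ≟ S
  ... | no S≢S = contradiction refl S≢S
  ... | yes refl with ≡-dec _≟_ a a
  ...   | yes _  = from (T-∨ {D S a}) (inj₂ tt)
  ...   | no a≢a = contradiction refl a≢a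

  insertTuple-cases : ∀ (D : DB τin n) S a R t → T (insertTuple D S a R t) →
                      T (D R t) ⊎ (R , t) ≡ (S , a)
  insertTuple-cases D S a R t p with R ≟ S
  ... | no _ = inj₁ p
  ... | yes refl with to (T-∨ {D R t}) p
  ...   | inj₁ q = inj₁ q
  ...   | inj₂ q with ≡-dec _≟_ t a
  ...     | yes refl = inj₂ refl
  ...     | no _     = ⊥-elim q

  Atom : ℕ → Set
  Atom V = Σ Sym (λ R → Vec (Fin V) (ar R))

  Forcing : SemiPosQF φ → Set
  Forcing (atom _ _) = Bool
  Forcing (eq _ _)   = ⊤
  Forcing (neq _ _)  = ⊤
  Forcing (and p q)  = Forcing p × Forcing q
  Forcing (or p q)   = Forcing p × Forcing q

  finite-Forcing : (p : SemiPosQF φ) → Finite (Forcing p)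
  finite-Forcing (atom _ _) = finite-Bool
  finite-Forcing (eq _ _)   = finite-⊤
  finite-Forcing (neq _ _)  = finite-⊤
  finite-Forcing (and p q)  = finite-× (finite-Forcing p) (finite-Forcing q)
  finite-Forcing (or p q)   = finite-× (finite-Forcing p) (finite-Forcing q)

  unforced : (p : SemiPosQF φ) → Forcing p
  unforced (atom _ _) = false
  unforced (eq _ _)   = tt
  unforced (neq _ _)  = tt
  unforced (and p q)  = unforced p , unforced q
  unforced (or p q)   = unforced p , unforced q

  #unforced : (p : SemiPosQF φ) → Forcing p → ℕ
  #unforced (atom _ _) true    = 0
  #unforced (atom _ _) false   = 1
  #unforced (eq _ _)   _       = 0
  #unforced (neq _ _)  _       = 0
  #unforced (and p q)  (F , G) = #unforced p F + #unforced q G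
  #unforced (or p q)   (F , G) = #unforced p F + #unforced q G

  Occurrence : SemiPosQF φ → Set
  Occurrence (atom _ _) = ⊤
  Occurrence (eq _ _)   = ⊥
  Occurrence (neq _ _)  = ⊥
  Occurrence (and p q)  = Occurrence p ⊎ Occurrence q
  Occurrence (or p q)   = Occurrence p ⊎ Occurrence q

  atomAt : {φ : Formula (sig τin) V} (p : SemiPosQF φ) → Occurrence p → Atom V
  atomAt (atom R xs) _        = R , xs
  atomAt (and p q)   (inj₁ β) = atomAt p β
  atomAt (and p q)   (inj₂ β) = atomAt q β
  atomAt (or p q)    (inj₁ β) = atomAt p β
  atomAt (or p q)    (inj₂ β) = atomAt q β

  isForced : (p : SemiPosQF φ) → Forcing p → Occurrence p → Bool
  isForced (atom _ _) F       _        = F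
  isForced (and p q)  (F , G) (inj₁ β) = isForced p F β
  isForced (and p q)  (F , G) (inj₂ β) = isForced q G β
  isForced (or p q)   (F , G) (inj₁ β) = isForced p F β
  isForced (or p q)   (F , G) (inj₂ β) = isForced q G β

  force : (p : SemiPosQF φ) → Forcing p → Occurrence p → Forcing p
  force (atom _ _) F       _        = true
  force (and p q)  (F , G) (inj₁ β) = force p F β , G
  force (and p q)  (F , G) (inj₂ β) = F , force q G β
  force (or p q)   (F , G) (inj₁ β) = force p F β , G
  force (or p q)   (F , G) (inj₂ β) = F , force q G β

  #unforced-force : ∀ (p : SemiPosQF φ) F β → isForced p F β ≡ false →
                    #unforced p (force p F β) < #unforced p F
  #unforced-force (atom _ _) false   _        _ = ≤-refl
  #unforced-force (and p q)  (F , G) (inj₁ β) e = +-monoˡ-< (#unforced q G) (#unforced-force p F β e)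
  #unforced-force (and p q)  (F , G) (inj₂ β) e = +-monoʳ-< (#unforced p F) (#unforced-force q G β e)
  #unforced-force (or p q)   (F , G) (inj₁ β) e = +-monoˡ-< (#unforced q G) (#unforced-force p F β e)
  #unforced-force (or p q)   (F , G) (inj₂ β) e = +-monoʳ-< (#unforced p F) (#unforced-force q G β e)

  #unforced≤ : ∀ (p : SemiPosQF φ) F → #unforced p F ≤ #unforced p (unforced p)
  #unforced≤ (atom _ _) true    = z≤n
  #unforced≤ (atom _ _) false   = ≤-refl
  #unforced≤ (eq _ _)   _       = z≤n
  #unforced≤ (neq _ _)  _       = z≤n
  #unforced≤ (and p q)  (F , G) = +-mono-≤ (#unforced≤ p F) (#unforced≤ q G)
  #unforced≤ (or p q)   (F , G) = +-mono-≤ (#unforced≤ p F) (#unforced≤ q G)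

  holds : {φ : Formula (sig τin) V} (p : SemiPosQF φ) → DB τin n → Forcing p → Vec (Fin n) V → Bool
  holds (atom R xs) D F       ρ = F ∨ D R (map (lookup ρ) xs)
  holds (eq x y)    D _       ρ = ⌊ lookup ρ x ≟ lookup ρ y ⌋
  holds (neq x y)   D _       ρ = not ⌊ lookup ρ x ≟ lookup ρ y ⌋
  holds (and p q)   D (F , G) ρ = holds p D F ρ ∧ holds q D G ρ
  holds (or p q)    D (F , G) ρ = holds p D F ρ ∨ holds q D G ρ

  holds-unforced : ∀ (p : SemiPosQF φ) (D : DB τin n) ρ →
                   holds p D (unforced p) ρ ≡ eval D φ ρ
  holds-unforced (atom _ _) D ρ = refl
  holds-unforced (eq _ _)   D ρ = refl
  holds-unforced (neq _ _)  D ρ = refl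
  holds-unforced (and p q)  D ρ = cong₂ _∧_ (holds-unforced p D ρ) (holds-unforced q D ρ)
  holds-unforced (or p q)   D ρ = cong₂ _∨_ (holds-unforced p D ρ) (holds-unforced q D ρ)

  holds-mono : ∀ (p : SemiPosQF φ) {D D′ : DB τin n} →
               (∀ R t → T (D R t) → T (D′ R t)) → ∀ F {ρ} → T (holds p D F ρ) → T (holds p D′ F ρ)
  holds-mono (atom R xs) D⊆D′ F = ∨-map {F} id (D⊆D′ R _)
  holds-mono (eq _ _)    D⊆D′ _ = λ h → h
  holds-mono (neq _ _)   D⊆D′ _ = λ h → h
  holds-mono (and p q)   D⊆D′ (F , G) = ∧-map (holds-mono p D⊆D′ F) (holds-mono q D⊆D′ G)
  holds-mono (or p q)    D⊆D′ (F , G) = ∨-map (holds-mono p D⊆D′ F) (holds-mono q D⊆D′ G)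

  holds-force : ∀ (p : SemiPosQF φ) {D : DB τin n} F β {ρ} →
                T (holds p D F ρ) → T (holds p D (force p F β) ρ)
  holds-force (atom _ _) F       _        = λ _ → tt
  holds-force (and p q)  (F , G) (inj₁ β) = ∧-map (holds-force p F β) id
  holds-force (and p q)  (F , G) (inj₂ β) = ∧-map id (holds-force q G β)
  holds-force (or p q)   (F , G) (inj₁ β) = ∨-map (holds-force p F β) id
  holds-force (or p q)   (F , G) (inj₂ β) = ∨-map id (holds-force q G β)

  holds-unforce : ∀ (p : SemiPosQF φ) {D : DB τin n} F β {ρ} →
                  let R , zs = atomAt p β in T (D R (map (lookup ρ) zs)) →
                  T (holds p D (force p F β) ρ) → T (holds p D F ρ)
  holds-unforce (atom _ _) F       _        Rzs = λ _ → from (T-∨ {F}) (inj₂ Rzs)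
  holds-unforce (and p q)  (F , G) (inj₁ β) Rzs = ∧-map (holds-unforce p F β Rzs) id
  holds-unforce (and p q)  (F , G) (inj₂ β) Rzs = ∧-map id (holds-unforce q G β Rzs)
  holds-unforce (or p q)   (F , G) (inj₁ β) Rzs = ∨-map (holds-unforce p F β Rzs) id
  holds-unforce (or p q)   (F , G) (inj₂ β) Rzs = ∨-map id (holds-unforce q G β Rzs)

  Matches : {φ : Formula (sig τin) V} (p : SemiPosQF φ) → Forcing p → Vec (Fin n) V →
            (S : Sym) → Vec (Fin n) (ar S) → Set
  Matches p F ρ S a =
    ∃[ β ] isForced p F β ≡ false × ∃[ zs ] atomAt p β ≡ (S , zs) × map (lookup ρ) zs ≡ a

  holds-insert : ∀ (p : SemiPosQF φ) {D : DB τin n} {S a} F {ρ} →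
                 T (holds p (insertTuple D S a) F ρ) → T (holds p D F ρ) ⊎ Matches p F ρ S a
  holds-insert (atom _ _)  true  _ = inj₁ tt
  holds-insert (atom R xs) {D} {S} {a} false {ρ} h with insertTuple-cases D S a R (map (lookup ρ) xs) h
  ... | inj₁ old  = inj₁ old
  ... | inj₂ refl = inj₂ (tt , refl , xs , refl , refl)
  holds-insert (eq _ _)  _ h = inj₁ h
  holds-insert (neq _ _) _ h = inj₁ h
  holds-insert (and p q) {D} (F , G) {ρ} h with to (T-∧ {holds p (insertTuple D _ _) F ρ}) h
  ... | hp , hq with holds-insert p F hp | holds-insert q G hq
  ...   | inj₁ old-p | inj₁ old-q = inj₁ (from (T-∧ {holds p D F ρ}) (old-p , old-q))
  ...   | inj₂ new   | _          = inj₂ (Product.map inj₁ id new)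
  ...   | inj₁ _     | inj₂ new   = inj₂ (Product.map inj₂ id new)
  holds-insert (or p q) {D} (F , G) {ρ} h with to (T-∨ {holds p (insertTuple D _ _) F ρ}) h
  ... | inj₁ hp = Sum.map (from (T-∨ {holds p D F ρ}) ∘ inj₁) (Product.map inj₁ id) (holds-insert p F hp)
  ... | inj₂ hq = Sum.map (from (T-∨ {holds p D F ρ}) ∘ inj₂) (Product.map inj₂ id) (holds-insert q G hq)


module _ {A : Set} where

  map-lookup-++-↑ˡ : ∀ (a : Vec A m) (b : Vec A n) → map (lookup (a ++ b)) (tabulate (_↑ˡ n)) ≡ a
  map-lookup-++-↑ˡ a b =
    trans (sym (tabulate-∘ _ _)) (trans (tabulate-cong (lookup-++ˡ a b)) (tabulate∘lookup a))

  map-lookup-++-↑ʳ : ∀ (a : Vec A m) (b : Vec A n) → map (lookup (a ++ b)) (tabulate (m ↑ʳ_)) ≡ b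
  map-lookup-++-↑ʳ a b =
    trans (sym (tabulate-∘ _ _)) (trans (tabulate-cong (lookup-++ʳ a b)) (tabulate∘lookup b))

-- The dynamic program

module Construction (τin : Schema) (ℓ k : ℕ) {ψ : Formula (sig τin) (k + ℓ)} (ψ-sp : SemiPosQF ψ) where
  private
    Sym = Schema.Sym τin
    arS = Schema.ar τin
    variable φ : Formula (sig τin) V

  Index : Set
  Index = PartialPattern (k + ℓ) × Forcing ψ-sp

  finite-Index : Finite Index
  finite-Index = finite-× (finite-PartialPattern (k + ℓ)) (finite-Forcing ψ-sp)

  index : Fin (size finite-Index) → Index
  index = Inverse.to (enum finite-Index)

  symbolOf : Index → Fin (size finite-Index)
  symbolOf = Inverse.from (enum finite-Index)

  index-symbolOf : ∀ j → index (symbolOf j) ≡ j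
  index-symbolOf = Inverse.strictlyInverseˡ (enum finite-Index)

  auxArity : Index → ℕ
  auxArity (x , _) = #bound (toPattern x)

  pattern dummy = zero
  pattern query = suc zero
  pattern aux i = suc (suc i)

  arity : Fin (2 + size finite-Index) → ℕ
  arity dummy   = 0
  arity query   = ℓ
  arity (aux i) = auxArity (index i)

  τaux : Schema
  τaux = record { size = 2 + size finite-Index ; ar = arity }

  τ : Sig
  τ = τin ⊕ τaux

  sat : DB τin n → Forcing ψ-sp → Vec (Maybe (Fin n)) (k + ℓ) → Bool
  sat D F σ = anyExtension σ (holds ψ-sp D F)

  queryPattern : ∀ {A : Set} → Vec A ℓ → Vec (Maybe A) (k + ℓ)
  queryPattern b = replicate k nothing ++ map just b

  module _ {w : ℕ} where

    -- Formulas may have no variables at all, so truth values come from the dummy nullary relation.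
    ⊤ᶠ ⊥ᶠ : Formula τ w
    ⊤ᶠ = or  (atom (inj₂ dummy) []) (neg (atom (inj₂ dummy) []))
    ⊥ᶠ = and (atom (inj₂ dummy) []) (neg (atom (inj₂ dummy) []))

    direct : {φ : Formula (sig τin) V} (p : SemiPosQF φ) → Forcing p → Vec (Fin w) V → Formula τ w
    direct (atom R xs) true    t = ⊤ᶠ
    direct (atom R xs) false   t = atom (inj₁ R) (map (lookup t) xs)
    direct (eq x y)    _       t = eq (lookup t x) (lookup t y)
    direct (neq x y)   _       t = neg (eq (lookup t x) (lookup t y))
    direct (and p q)   (F , G) t = and (direct p F t) (direct q G t)
    direct (or p q)    (F , G) t = or  (direct p F t) (direct q G t)

    auxAtom : (j : Index) → Vec (Fin w) (auxArity j) → Formula τ w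
    auxAtom j args =
      atom (inj₂ (aux (symbolOf j))) (subst (Vec (Fin w)) (cong auxArity (sym (index-symbolOf j))) args)

    satFormula : Forcing ψ-sp → Vec (Maybe (Fin w)) (k + ℓ) → Formula τ w
    satFormula F σ with totality σ
    ... | total t _        = direct ψ-sp F t
    ... | partial x args _ = auxAtom (x , F) args

    agreeAt : Maybe (Fin w) → Fin w → Formula τ w
    agreeAt (just u) c = eq u c
    agreeAt nothing  c = ⊥ᶠ

    agree : Vec (Maybe (Fin w)) V → Vec (Fin V) m → Vec (Fin w) m → Formula τ w
    agree σ []       []       = ⊤ᶠ
    agree σ (z ∷ zs) (c ∷ cs) = and (agreeAt (lookup σ z) c) (agree σ zs cs)

    anyOccurrence : (p : SemiPosQF φ) → (Occurrence p → Formula τ w) → Formula τ w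
    anyOccurrence (atom _ _) body = body tt
    anyOccurrence (eq _ _)   body = ⊥ᶠ
    anyOccurrence (neq _ _)  body = ⊥ᶠ
    anyOccurrence (and p q)  body = or (anyOccurrence p (body ∘ inj₁)) (anyOccurrence q (body ∘ inj₂))
    anyOccurrence (or p q)   body = or (anyOccurrence p (body ∘ inj₁)) (anyOccurrence q (body ∘ inj₂))

    ifUnforced : Bool → Formula τ w → Formula τ w
    ifUnforced true  φ = ⊥ᶠ
    ifUnforced false φ = φ

    ifSymbol : (S : Sym) → Atom {τin} V → (Vec (Fin V) (arS S) → Formula τ w) → Formula τ w
    ifSymbol S (R , zs) body with R ≟ S
    ... | yes refl = body zs
    ... | no _     = ⊥ᶠ

    -- sat after inserting S(a): either σ was already satisfiable, or some unforced S-atom is sent to a,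
    -- so its variables are bound to a (agree rejects clashes with earlier or repeated bindings) and it
    -- is forced. f bounds the number of unfoldings.
    satAfterInsert : (S : Sym) → Vec (Fin w) (arS S) → ℕ → Forcing ψ-sp →
                     Vec (Maybe (Fin w)) (k + ℓ) → Formula τ w
    viaOccurrence  : (S : Sym) → Vec (Fin w) (arS S) → ℕ → Forcing ψ-sp →
                     Vec (Maybe (Fin w)) (k + ℓ) → Occurrence ψ-sp → Formula τ w
    viaMatch       : (S : Sym) → Vec (Fin w) (arS S) → ℕ → Forcing ψ-sp →
                     Vec (Maybe (Fin w)) (k + ℓ) → Vec (Fin (k + ℓ)) (arS S) → Formula τ w

    satAfterInsert S a zero    F σ = satFormula F σ
    satAfterInsert S a (suc f) F σ = or (satFormula F σ) (anyOccurrence ψ-sp (viaOccurrence S a f F σ))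

    viaOccurrence S a f F σ β =
      ifUnforced (isForced ψ-sp F β) (ifSymbol S (atomAt ψ-sp β) (viaMatch S a f (force ψ-sp F β) σ))

    viaMatch S a f F σ zs = and (satAfterInsert S a f F (bind zs a σ)) (agree (bind zs a σ) zs a)

    qf-⊤ᶠ : QF ⊤ᶠ
    qf-⊤ᶠ = or (atom _ _) (neg (atom _ _))

    qf-⊥ᶠ : QF ⊥ᶠ
    qf-⊥ᶠ = and (atom _ _) (neg (atom _ _))

    qf-direct : ∀ {φ : Formula (sig τin) V} (p : SemiPosQF φ) F (t : Vec (Fin w) V) → QF (direct p F t)
    qf-direct (atom _ _) true    t = qf-⊤ᶠ
    qf-direct (atom _ _) false   t = atom _ _
    qf-direct (eq _ _)   _       t = eq _ _
    qf-direct (neq _ _)  _       t = neg (eq _ _)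
    qf-direct (and p q)  (F , G) t = and (qf-direct p F t) (qf-direct q G t)
    qf-direct (or p q)   (F , G) t = or  (qf-direct p F t) (qf-direct q G t)

    qf-satFormula : ∀ F σ → QF (satFormula F σ)
    qf-satFormula F σ with totality σ
    ... | total t _        = qf-direct ψ-sp F t
    ... | partial x args _ = atom _ _

    qf-agree : ∀ (σ : Vec (Maybe (Fin w)) V) (zs : Vec (Fin V) m) cs → QF (agree σ zs cs)
    qf-agree σ []       []       = qf-⊤ᶠ
    qf-agree σ (z ∷ zs) (c ∷ cs) = and (qf-agreeAt (lookup σ z)) (qf-agree σ zs cs)
      where
      qf-agreeAt : ∀ u → QF (agreeAt u c)
      qf-agreeAt (just _) = eq _ _
      qf-agreeAt nothing  = qf-⊥ᶠ

    qf-anyOccurrence : ∀ (p : SemiPosQF φ) {body : Occurrence p → Formula τ w} →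
                       (∀ β → QF (body β)) → QF (anyOccurrence p body)
    qf-anyOccurrence (atom _ _) qf-body = qf-body tt
    qf-anyOccurrence (eq _ _)   qf-body = qf-⊥ᶠ
    qf-anyOccurrence (neq _ _)  qf-body = qf-⊥ᶠ
    qf-anyOccurrence (and p q)  qf-body =
      or (qf-anyOccurrence p (qf-body ∘ inj₁)) (qf-anyOccurrence q (qf-body ∘ inj₂))
    qf-anyOccurrence (or p q)   qf-body =
      or (qf-anyOccurrence p (qf-body ∘ inj₁)) (qf-anyOccurrence q (qf-body ∘ inj₂))

    qf-ifUnforced : ∀ b {φ : Formula τ w} → QF φ → QF (ifUnforced b φ)
    qf-ifUnforced true  _    = qf-⊥ᶠ
    qf-ifUnforced false qf-φ = qf-φ

    qf-ifSymbol : ∀ S (atm : Atom {τin} V) {body} → (∀ zs → QF (body zs)) → QF (ifSymbol S atm body)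
    qf-ifSymbol S (R , zs) qf-body with R ≟ S
    ... | yes refl = qf-body zs
    ... | no _     = qf-⊥ᶠ

    qf-satAfterInsert : ∀ S a f F σ → QF (satAfterInsert S a f F σ)
    qf-satAfterInsert S a zero    F σ = qf-satFormula F σ
    qf-satAfterInsert S a (suc f) F σ = or (qf-satFormula F σ) (qf-anyOccurrence ψ-sp λ β →
      qf-ifUnforced (isForced ψ-sp F β) (qf-ifSymbol S (atomAt ψ-sp β) λ zs →
        and (qf-satAfterInsert S a f (force ψ-sp F β) (bind zs a σ)) (qf-agree (bind zs a σ) zs a)))

  satAt : DB τin n → (j : Index) → Vec (Fin n) (auxArity j) → Bool
  satAt D (x , F) args = sat D F (instantiate (toPattern x) args)

  record Invariant (D : DB τin n) (A : DB τaux n) : Set where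
    field
      aux-sat   : ∀ i args → A (aux i) args ≡ satAt D (index i) args
      query-sat : ∀ b → A query b ≡ sat D (unforced ψ-sp) (queryPattern b)

  module Semantics (D : DB τin n) (A : DB τaux n) (env : Vec (Fin n) w) where

    ev : Formula τ w → Bool
    ev φ = eval (combine (state D A)) φ env

    ⟪_⟫ : Vec (Maybe (Fin w)) V → Vec (Maybe (Fin n)) V
    ⟪ σ ⟫ = map (Maybe.map (lookup env)) σ

    ev-and : ∀ φ₁ {b} → T (ev φ₁ ∧ b) ⇔ (T (ev φ₁) × T b)
    ev-and φ₁ = T-∧ {ev φ₁}

    ev-or : ∀ φ₁ {b} → T (ev φ₁ ∨ b) ⇔ (T (ev φ₁) ⊎ T b)
    ev-or φ₁ = T-∨ {ev φ₁}

    ev-⊤ᶠ : ev ⊤ᶠ ≡ true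
    ev-⊤ᶠ = ∨-inverseʳ (A dummy [])

    ev-⊥ᶠ : ¬ T (ev ⊥ᶠ)
    ev-⊥ᶠ h = subst T (∧-inverseʳ (A dummy [])) h

    map-lookup-map : ∀ (t : Vec (Fin w) V) (xs : Vec (Fin V) m) →
                     map (lookup env) (map (lookup t) xs) ≡ map (lookup (map (lookup env) t)) xs
    map-lookup-map t xs = trans (sym (map-∘ _ _ xs)) (map-cong (λ x → sym (lookup-map x (lookup env) t)) xs)

    ev-direct : ∀ (p : SemiPosQF φ) F t → ev (direct p F t) ≡ holds p D F (map (lookup env) t)
    ev-direct (atom R xs) true    t = ev-⊤ᶠ
    ev-direct (atom R xs) false   t = cong (D R) (map-lookup-map t xs)
    ev-direct (eq x y)    _       t =
      cong₂ (λ u v → ⌊ u ≟ v ⌋) (sym (lookup-map x _ t)) (sym (lookup-map y _ t))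
    ev-direct (neq x y)   _       t =
      cong₂ (λ u v → not ⌊ u ≟ v ⌋) (sym (lookup-map x _ t)) (sym (lookup-map y _ t))
    ev-direct (and p q)   (F , G) t = cong₂ _∧_ (ev-direct p F t) (ev-direct q G t)
    ev-direct (or p q)    (F , G) t = cong₂ _∨_ (ev-direct p F t) (ev-direct q G t)

    ev-auxAtom : Invariant D A → ∀ j args → ev (auxAtom j args) ≡ satAt D j (map (lookup env) args)
    ev-auxAtom inv j args = trans (Invariant.aux-sat inv (symbolOf j) _) (transport (index-symbolOf j))
      where
      transport : ∀ {j′} (e : j′ ≡ j) →
                  satAt D j′ (map (lookup env) (subst (Vec (Fin w)) (cong auxArity (sym e)) args)) ≡
                  satAt D j (map (lookup env) args)
      transport refl = refl

    ev-satFormula : Invariant D A → ∀ F σ → ev (satFormula F σ) ≡ sat D F ⟪ σ ⟫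
    ev-satFormula inv F σ with totality σ
    ... | total t refl = begin
      ev (direct ψ-sp F t)                     ≡⟨ ev-direct ψ-sp F t ⟩
      holds ψ-sp D F (map (lookup env) t)      ≡⟨ anyExtension-total (map (lookup env) t) (holds ψ-sp D F) ⟨
      sat D F (map just (map (lookup env) t))  ≡⟨ cong (sat D F) (trans (sym (map-∘ _ _ t)) (map-∘ _ _ t)) ⟩
      sat D F ⟪ map just t ⟫                   ∎
    ... | partial x args refl =
      trans (ev-auxAtom inv (x , F) args) (cong (sat D F) (map-instantiate (lookup env) (toPattern x) args))

    agreeAt-sound : ∀ {d} u c → MaybeAll (d ≡_) (Maybe.map (lookup env) u) → T (ev (agreeAt u c)) →
                    d ≡ lookup env c
    agreeAt-sound (just u) c (just d≡u) h = trans d≡u (toWitness h)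
    agreeAt-sound nothing  c _          h = ⊥-elim (ev-⊥ᶠ h)

    agreeAt-complete : ∀ {d} u c → Is-just u → MaybeAll (d ≡_) (Maybe.map (lookup env) u) →
                       d ≡ lookup env c → T (ev (agreeAt u c))
    agreeAt-complete (just u) c _ (just d≡u) d≡c = fromWitness (trans (sym d≡u) d≡c)

    extends-lookup⟪⟫ : ∀ {ρ : Vec (Fin n) V} {σ} → Extends ρ ⟪ σ ⟫ →
                       ∀ z → MaybeAll (lookup ρ z ≡_) (Maybe.map (lookup env) (lookup σ z))
    extends-lookup⟪⟫ {σ = σ} ρ⊒σ z = subst (MaybeAll _) (lookup-map z _ σ) (Pointwise.lookup ρ⊒σ z)

    agree-sound : ∀ {ρ : Vec (Fin n) V} σ (zs : Vec (Fin V) m) cs → Extends ρ ⟪ σ ⟫ →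
                  T (ev (agree σ zs cs)) → map (lookup ρ) zs ≡ map (lookup env) cs
    agree-sound σ []       []       ρ⊒σ h = refl
    agree-sound σ (z ∷ zs) (c ∷ cs) ρ⊒σ h = let hz , hzs = to (ev-and (agreeAt (lookup σ z) c)) h in
      cong₂ _∷_ (agreeAt-sound (lookup σ z) c (extends-lookup⟪⟫ ρ⊒σ z) hz) (agree-sound σ zs cs ρ⊒σ hzs)

    agree-complete : ∀ {ρ : Vec (Fin n) V} σ (zs : Vec (Fin V) m) cs →
                     VecAll.All (λ z → Is-just (lookup σ z)) zs → Extends ρ ⟪ σ ⟫ →
                     map (lookup ρ) zs ≡ map (lookup env) cs → T (ev (agree σ zs cs))
    agree-complete σ []       []       _                   ρ⊒σ _ = subst T (sym ev-⊤ᶠ) tt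
    agree-complete σ (z ∷ zs) (c ∷ cs) (bound VecAll.∷ bounds) ρ⊒σ ρzs≡cs =
      let ρz≡c , ρzs≡cs′ = ∷-injective ρzs≡cs in
      from (ev-and (agreeAt (lookup σ z) c))
        ( agreeAt-complete (lookup σ z) c bound (extends-lookup⟪⟫ ρ⊒σ z) ρz≡c
        , agree-complete σ zs cs bounds ρ⊒σ ρzs≡cs′)

    anyOccurrence-sound : ∀ (p : SemiPosQF φ) body → T (ev (anyOccurrence p body)) →
                          ∃[ β ] T (ev (body β))
    anyOccurrence-sound (atom _ _) body h = tt , h
    anyOccurrence-sound (eq _ _)   body h = ⊥-elim (ev-⊥ᶠ h)
    anyOccurrence-sound (neq _ _)  body h = ⊥-elim (ev-⊥ᶠ h)
    anyOccurrence-sound (and p q)  body h with to (ev-or (anyOccurrence p (body ∘ inj₁))) h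
    ... | inj₁ hp = Product.map inj₁ id (anyOccurrence-sound p (body ∘ inj₁) hp)
    ... | inj₂ hq = Product.map inj₂ id (anyOccurrence-sound q (body ∘ inj₂) hq)
    anyOccurrence-sound (or p q)   body h with to (ev-or (anyOccurrence p (body ∘ inj₁))) h
    ... | inj₁ hp = Product.map inj₁ id (anyOccurrence-sound p (body ∘ inj₁) hp)
    ... | inj₂ hq = Product.map inj₂ id (anyOccurrence-sound q (body ∘ inj₂) hq)

    anyOccurrence-complete : ∀ (p : SemiPosQF φ) body β → T (ev (body β)) →
                             T (ev (anyOccurrence p body))
    anyOccurrence-complete (atom _ _) body _        h = h
    anyOccurrence-complete (and p q)  body (inj₁ β) h =
      from (ev-or (anyOccurrence p (body ∘ inj₁))) (inj₁ (anyOccurrence-complete p (body ∘ inj₁) β h))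
    anyOccurrence-complete (and p q)  body (inj₂ β) h =
      from (ev-or (anyOccurrence p (body ∘ inj₁))) (inj₂ (anyOccurrence-complete q (body ∘ inj₂) β h))
    anyOccurrence-complete (or p q)   body (inj₁ β) h =
      from (ev-or (anyOccurrence p (body ∘ inj₁))) (inj₁ (anyOccurrence-complete p (body ∘ inj₁) β h))
    anyOccurrence-complete (or p q)   body (inj₂ β) h =
      from (ev-or (anyOccurrence p (body ∘ inj₁))) (inj₂ (anyOccurrence-complete q (body ∘ inj₂) β h))

    ifUnforced-sound : ∀ b {φ} → T (ev (ifUnforced b φ)) → T (ev φ)
    ifUnforced-sound true  h = ⊥-elim (ev-⊥ᶠ h)
    ifUnforced-sound false h = h

    ifUnforced-complete : ∀ {b φ} → b ≡ false → T (ev φ) → T (ev (ifUnforced b φ))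
    ifUnforced-complete refl h = h

    ifSymbol-sound : ∀ S (atm : Atom {τin} V) body → T (ev (ifSymbol S atm body)) →
                     ∃[ zs ] atm ≡ (S , zs) × T (ev (body zs))
    ifSymbol-sound S (R , zs) body h with R ≟ S
    ... | yes refl = zs , refl , h
    ... | no _     = ⊥-elim (ev-⊥ᶠ h)

    ifSymbol-complete : ∀ {S} {atm : Atom {τin} V} {zs} body → atm ≡ (S , zs) → T (ev (body zs)) →
                        T (ev (ifSymbol S atm body))
    ifSymbol-complete {S = S} body refl h with S ≟ S
    ... | yes refl = h
    ... | no S≢S   = contradiction refl S≢S

    module Insertion (inv : Invariant D A) (S : Sym) (â : Vec (Fin w) (arS S)) where
      a : Vec (Fin n) (arS S)
      a = map (lookup env) â

      D′ : DB τin n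
      D′ = insertTuple D S a

      ⟪bind⟫ : ∀ (zs : Vec (Fin (k + ℓ)) (arS S)) σ → ⟪ bind zs â σ ⟫ ≡ bind zs a ⟪ σ ⟫
      ⟪bind⟫ zs σ = map-bind (lookup env) zs â σ

      satFormula-⊆ : ∀ F σ → T (ev (satFormula F σ)) → T (sat D′ F ⟪ σ ⟫)
      satFormula-⊆ F σ h =
        let ρ , ρ⊒σ , ρ⊨ = anyExtension-sound ⟪ σ ⟫ _ (subst T (ev-satFormula inv F σ) h)
        in  anyExtension-complete ⟪ σ ⟫ _ ρ⊒σ (holds-mono ψ-sp (insertTuple-⊇ D S a) F ρ⊨)

      matched-holds : ∀ {ρ : Vec (Fin n) (k + ℓ)} {atm : Atom {τin} (k + ℓ)} {zs} → atm ≡ (S , zs) →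
                      map (lookup ρ) zs ≡ a → T (D′ (proj₁ atm) (map (lookup ρ) (proj₂ atm)))
      matched-holds refl ρzs≡a = subst (T ∘ D′ S) (sym ρzs≡a) (insertTuple-new D S a)

      satAfterInsert-sound : ∀ f F σ → T (ev (satAfterInsert S â f F σ)) → T (sat D′ F ⟪ σ ⟫)
      satAfterInsert-sound zero    F σ h = satFormula-⊆ F σ h
      satAfterInsert-sound (suc f) F σ h with to (ev-or (satFormula F σ)) h
      ... | inj₁ old = satFormula-⊆ F σ old
      ... | inj₂ new =
        let β , h₁ = anyOccurrence-sound ψ-sp (viaOccurrence S â f F σ) new
            F′ = force ψ-sp F β
            zs , β≡S , h₂ = ifSymbol-sound S (atomAt ψ-sp β) (viaMatch S â f F′ σ)
                              (ifUnforced-sound (isForced ψ-sp F β) h₁)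
            σ′ = bind zs â σ
            h-sat , h-agree = to (ev-and (satAfterInsert S â f F′ σ′)) h₂
            ρ , ρ⊒σ′ , ρ⊨ = anyExtension-sound ⟪ σ′ ⟫ _ (satAfterInsert-sound f F′ σ′ h-sat)
            ρ⊒σ = extends-unbind zs a ⟪ σ ⟫ (subst (Extends ρ) (⟪bind⟫ zs σ) ρ⊒σ′)
        in  anyExtension-complete ⟪ σ ⟫ _ ρ⊒σ
              (holds-unforce ψ-sp F β (matched-holds {ρ = ρ} β≡S (agree-sound σ′ zs â ρ⊒σ′ h-agree)) ρ⊨)

      satFormula⇒satAfterInsert : ∀ f F σ → T (ev (satFormula F σ)) → T (ev (satAfterInsert S â f F σ))
      satFormula⇒satAfterInsert zero    F σ h = h
      satFormula⇒satAfterInsert (suc f) F σ h = from (ev-or (satFormula F σ)) (inj₁ h)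

      satAfterInsert-complete : ∀ f F σ → #unforced ψ-sp F ≤ f → T (sat D′ F ⟪ σ ⟫) →
                                T (ev (satAfterInsert S â f F σ))
      satAfterInsert-complete f F σ F≤f h with anyExtension-sound ⟪ σ ⟫ _ h
      ... | ρ , ρ⊒σ , ρ⊨ with holds-insert ψ-sp F ρ⊨
      ... | inj₁ old = satFormula⇒satAfterInsert f F σ
                         (subst T (sym (ev-satFormula inv F σ)) (anyExtension-complete ⟪ σ ⟫ _ ρ⊒σ old))
      ... | inj₂ (β , unforced-β , zs , β≡S , ρzs≡a) with f | ≤-trans (#unforced-force ψ-sp F β unforced-β) F≤f
      ...   | zero  | ()
      ...   | suc f | F′<f = from (ev-or (satFormula F σ)) (inj₂ via-β)
        where
        F′ = force ψ-sp F β
        σ′ = bind zs â σ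

        ρ⊒σ′ : Extends ρ ⟪ σ′ ⟫
        ρ⊒σ′ = subst (Extends ρ) (sym (⟪bind⟫ zs σ)) (extends-bind zs ρ⊒σ ρzs≡a)

        sat-σ′ : T (ev (satAfterInsert S â f F′ σ′))
        sat-σ′ = satAfterInsert-complete f F′ σ′ (≤-pred F′<f)
                   (anyExtension-complete ⟪ σ′ ⟫ _ ρ⊒σ′ (holds-force ψ-sp F β ρ⊨))

        agree-σ′ : T (ev (agree σ′ zs â))
        agree-σ′ = agree-complete σ′ zs â (bind-binds zs â σ) ρ⊒σ′ ρzs≡a

        via-β : T (ev (anyOccurrence ψ-sp (viaOccurrence S â f F σ)))
        via-β = anyOccurrence-complete ψ-sp _ β (ifUnforced-complete unforced-β
                  (ifSymbol-complete _ β≡S (from (ev-and (satAfterInsert S â f F′ σ′)) (sat-σ′ , agree-σ′))))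

      ev-satAfterInsert : ∀ f F σ → #unforced ψ-sp F ≤ f → ev (satAfterInsert S â f F σ) ≡ sat D′ F ⟪ σ ⟫
      ev-satAfterInsert f F σ F≤f =
        T-injective (mk⇔ (satAfterInsert-sound f F σ) (satAfterInsert-complete f F σ F≤f))

  queryPattern-map : ∀ {A B : Set} (f : A → B) (b : Vec A ℓ) →
                     map (Maybe.map f) (queryPattern b) ≡ queryPattern (map f b)
  queryPattern-map f b = trans (map-++ _ (replicate k nothing) _)
    (cong₂ _++_ (map-replicate _ nothing k) (trans (sym (map-∘ _ _ b)) (map-∘ _ _ b)))

  fuel : ℕ
  fuel = #unforced ψ-sp (unforced ψ-sp)

  module _ (S : Sym) where

    argVars : Vec (Fin (arS S + m)) (arS S)
    argVars = tabulate (_↑ˡ _)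

    tupleVars : Vec (Fin (arS S + m)) m
    tupleVars = tabulate (arS S ↑ʳ_)

    auxUpdate : (j : Index) → Formula τ (arS S + auxArity j)
    auxUpdate (x , F) = satAfterInsert S argVars fuel F (instantiate (toPattern x) tupleVars)

    insertUpdate : (R : Fin (2 + size finite-Index)) → UpdFormula τin τaux S R
    insertUpdate dummy   = ⊤ᶠ
    insertUpdate query   = satAfterInsert S argVars fuel (unforced ψ-sp) (queryPattern tupleVars)
    insertUpdate (aux i) = auxUpdate (index i)

  initAux : DB τin n → DB τaux n
  initAux D dummy   _    = false
  initAux D query   b    = sat D (unforced ψ-sp) (queryPattern b)
  initAux D (aux i) args = satAt D (index i) args

  -- Deletions never occur in maintenance under insertions, so their updates are arbitrary.
  program : DynProgram τin τaux ℓ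
  program = record
    { updIns = insertUpdate
    ; updDel = λ _ _ → ⊤ᶠ
    ; Init   = initAux
    ; Q      = query
    ; Q-ar   = refl
    }

  invariant-init : (D : DB τin n) → Invariant D (initAux D)
  invariant-init D = record { aux-sat = λ _ _ → refl ; query-sat = λ _ → refl }

  module _ {D : DB τin n} {A : DB τaux n} (inv : Invariant D A) (S : Sym) (a : Vec (Fin n) (arS S)) where

    update-correct : ∀ (b : Vec (Fin n) m) F σ {s} → Semantics.⟪_⟫ D A (a ++ b) σ ≡ s →
                     eval (combine (state D A)) (satAfterInsert S (argVars S) fuel F σ) (a ++ b) ≡
                     sat (insertTuple D S a) F s
    update-correct b F σ ⟪σ⟫≡s = trans (ev-satAfterInsert fuel F σ (#unforced≤ ψ-sp F))
      (cong₂ (λ a′ s′ → sat (insertTuple D S a′) F s′) (map-lookup-++-↑ˡ a b) ⟪σ⟫≡s)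
      where open Semantics.Insertion D A (a ++ b) inv S (argVars S) using (ev-satAfterInsert)

    invariant-insert : Invariant (insertTuple D S a)
                                 (λ R b → eval (combine (state D A)) (insertUpdate S R) (a ++ b))
    Invariant.aux-sat invariant-insert i = auxUpdate-correct (index i)
      where
      auxUpdate-correct : ∀ j args → eval (combine (state D A)) (auxUpdate S j) (a ++ args) ≡
                                     satAt (insertTuple D S a) j args
      auxUpdate-correct (x , F) args = update-correct args F _
        (trans (sym (map-instantiate _ (toPattern x) _)) (cong (instantiate (toPattern x)) (map-lookup-++-↑ʳ a args)))
    Invariant.query-sat invariant-insert b = update-correct b (unforced ψ-sp) _
      (trans (queryPattern-map _ _) (cong queryPattern (map-lookup-++-↑ʳ a b)))

  invariant-run : ∀ {D : DB τin n} {A} (α : List (Mod τin n)) → All IsInsertion α → Invariant D A →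
                  Invariant (applyMods D α) (State.aux (run program (state D A) α))
  invariant-run []            []                inv = inv
  invariant-run (ins S a ∷ α) (ins _ _ ∷ insα) inv = invariant-run α insα (invariant-insert inv S a)

  maintains : MaintainsUnderInsertions program (queryOf (exists^ k ψ))
  maintains n D α insα b = begin
    State.aux (run program (state D (initAux D)) α) query b
      ≡⟨ Invariant.query-sat (invariant-run α insα (invariant-init D)) b ⟩
    sat D′ (unforced ψ-sp) (queryPattern b)
      ≡⟨ anyExtension-cong (queryPattern b) (holds-unforced ψ-sp D′) ⟩
    anyExtension (queryPattern b) (eval D′ ψ)
      ≡⟨ eval-exists^ D′ k ψ b ⟨
    eval D′ (exists^ k ψ) b
      ∎
    where D′ = applyMods D α

  isDynProp : IsDynProp program
  isDynProp = qf-insertUpdate , λ _ _ → qf-⊤ᶠ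
    where
    qf-insertUpdate : ∀ S R → QF (insertUpdate S R)
    qf-insertUpdate S dummy   = qf-⊤ᶠ
    qf-insertUpdate S query   = qf-satAfterInsert S (argVars S) fuel (unforced ψ-sp) (queryPattern (tupleVars S))
    qf-insertUpdate S (aux i) = qf-auxUpdate (index i)
      where
      qf-auxUpdate : ∀ j → QF (auxUpdate S j)
      qf-auxUpdate (x , F) = qf-satAfterInsert S (argVars S) fuel F (instantiate (toPattern x) (tupleVars S))

  auxArity≤ : ∀ j → auxArity j ≤ ℓ + k ∸ 1
  auxArity≤ (x , _) =
    subst (#bound (toPattern x) ≤_) pred[k+ℓ]≡ℓ+k∸1 (suc[m]≤n⇒m≤pred[n] (#bound-toPattern< x))
    where pred[k+ℓ]≡ℓ+k∸1 = trans (cong pred (+-comm k ℓ)) (pred[m∸n]≡m∸[1+n] (ℓ + k) 0)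

  isAry : IsAry program (ℓ ⊔ (ℓ + k ∸ 1))
  isAry dummy   = z≤n
  isAry query   = m≤m⊔n ℓ _
  isAry (aux i) = ≤-trans (auxArity≤ (index i)) (m≤n⊔m ℓ _)

theorem4p1 : (τin : Schema) (ℓ k : ℕ) (ψ : Formula (sig τin) (k + ℓ)) → SemiPosQF ψ →
    Σ Schema λ τaux → Σ (DynProgram τin τaux ℓ) λ P →
      IsDynProp P × IsAry P (ℓ ⊔ (ℓ + k ∸ 1)) × MaintainsUnderInsertions P (queryOf (exists^ k ψ))
theorem4p1 τin ℓ k ψ ψ-sp = τaux , program , isDynProp , isAry , maintains
  where open Construction τin ℓ k ψ-sp
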